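{- Let $T$ be a finite rooted tree with edges directed away from the root. Classify its vertices as follows: a vertex is a $P$-position if and only if at most one of its children is a $P$-position, and an $N$-position otherwise; a $P$-position is in $P_0$ if none of its children is a $P$-position and in $P_1$ if exactly one of its children is a $P$-position. Then the maximum number of edges in a path-collection of $T$ equals $2|N|+|P_1|$.
   Context: A path-collection in a graph is a set of edges such that no vertex is incident to more than two edges of the set. (The classification corresponds to the "comply-constrain" variant of the game Slither; leaves belong to $P_0$.) -}

module Defs where

open import Data.Nat using (ℕ; zero; suc; _+_; _*_; _≤_; _≤ᵇ_)
open import Data.Bool using (Bool; true; false; if_then_else_)
open import Data.List using (List; []; _∷_)
open import Data.Product using (_×_; _,_)
open import Data.Unit using (⊤)

-- A finite rooted tree: a root together with the (finite) list of subtrees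
-- rooted at its children.  Edges go from each vertex to each of its children.
data Tree : Set where
  node : List Tree → Tree

mutual
  isP : Tree → Bool
  isP (node ts) = pChildren ts ≤ᵇ 1

  pChildren : List Tree → ℕ
  pChildren []       = 0
  pChildren (t ∷ ts) = (if isP t then 1 else 0) + pChildren ts

isN-root : Tree → ℕ
isN-root t = if isP t then 0 else 1

isP₁-root : Tree → ℕ
isP₁-root (node ts) with isP (node ts) | pChildren ts
... | true  | 1 = 1
... | _     | _ = 0

mutual
  countN : Tree → ℕ
  countN (node ts) = isN-root (node ts) + countNs ts

  countNs : List Tree → ℕ
  countNs []       = 0
  countNs (t ∷ ts) = countN t + countNs ts

mutual
  countP₁ : Tree → ℕ
  countP₁ (node ts) = isP₁-root (node ts) + countP₁s ts

  countP₁s : List Tree → ℕ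
  countP₁s []       = 0
  countP₁s (t ∷ ts) = countP₁ t + countP₁s ts

-- Edge subsets of a tree: each parent–child edge is marked chosen (true)
-- or not (false).

mutual
  data EdgeSet : Tree → Set where
    node : ∀ {ts} → EdgeSets ts → EdgeSet (node ts)

  data EdgeSets : List Tree → Set where
    []  : EdgeSets []
    _∷_ : ∀ {t ts} → Bool × EdgeSet t → EdgeSets ts → EdgeSets (t ∷ ts)

chosenChildEdges : ∀ {ts} → EdgeSets ts → ℕ
chosenChildEdges []              = 0
chosenChildEdges ((b , _) ∷ ss)  = (if b then 1 else 0) + chosenChildEdges ss

mutual
  size : ∀ {t} → EdgeSet t → ℕ
  size (node ss) = sizes ss

  sizes : ∀ {ts} → EdgeSets ts → ℕ
  sizes []             = 0
  sizes ((b , s) ∷ ss) = (if b then 1 else 0) + size s + sizes ss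

mutual
  -- Degree condition: `Deg≤2 d S` says every vertex of the tree has at most two
  -- incident chosen edges, where d (0 or 1) is the number of chosen edges
  -- joining the root of this subtree to its parent.
  Deg≤2 : ∀ {t} → ℕ → EdgeSet t → Set
  Deg≤2 d (node ss) = (d + chosenChildEdges ss ≤ 2) × Deg≤2s ss

  Deg≤2s : ∀ {ts} → EdgeSets ts → Set
  Deg≤2s []             = ⊤
  Deg≤2s ((b , s) ∷ ss) = Deg≤2 (if b then 1 else 0) s × Deg≤2s ss

-- A path-collection of T: an edge set in which no vertex is incident to more
-- than two chosen edges (the root of T has no parent edge).
IsPathCollection : ∀ {t} → EdgeSet t → Set
IsPathCollection S = Deg≤2 0 S

{-# OPTIONS --safe #-}
module Submission where

-- Since an N-vertex has at
-- least two P-children and a P-vertex at most one, value satisfies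
-- value (node ts) = min(2, #P-children) + Σ value(child).  A path-collection
-- restricted to a subtree whose root already uses its parent edge has at
-- most value t - [root ∈ N] edges: every chosen edge into a child costs that
-- child nothing if it is a P-vertex and exactly one edge if it is an
-- N-vertex, and the root's remaining degree bounds the number of free edges.
-- Conversely, greedily choosing edges into as many P-children as the degree
-- budget allows attains the bound.

open import Defs
open import Data.Nat using (ℕ; zero; suc; _+_; _*_; _≤_; _⊓_; z≤n; s≤s)
open import Data.Nat.Properties
open import Data.Nat.Solver using (module +-*-Solver)
open import Data.Bool using (Bool; true; false; if_then_else_)
open import Data.List using (List; []; _∷_)
open import Data.Product using (Σ; _×_; _,_)
open import Data.Unit using (tt)
open import Relation.Binary.PropositionalEquality
open +-*-Solver using (solve; _:+_; _:*_; con; _:=_)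

bit : Bool → ℕ
bit b = if b then 1 else 0

value : Tree → ℕ
value t = 2 * countN t + countP₁ t

values : List Tree → ℕ
values ts = 2 * countNs ts + countP₁s ts

double-+-interchange : ∀ a b c d → 2 * (a + b) + (c + d) ≡ (2 * a + c) + (2 * b + d)
double-+-interchange = solve 4 (λ a b c d →
  con 2 :* (a :+ b) :+ (c :+ d) := (con 2 :* a :+ c) :+ (con 2 :* b :+ d)) refl

values-∷ : ∀ t ts → values (t ∷ ts) ≡ value t + values ts
values-∷ t ts = double-+-interchange (countN t) (countNs ts) (countP₁ t) (countP₁s ts)

root-value : ∀ ts → 2 * isN-root (node ts) + isP₁-root (node ts) ≡ 2 ⊓ pChildren ts
root-value ts with pChildren ts
... | 0           = refl
... | 1           = refl
... | suc (suc _) = refl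

value-node : ∀ ts → value (node ts) ≡ 2 ⊓ pChildren ts + values ts
value-node ts = begin
  2 * (isN-root (node ts) + countNs ts) + (isP₁-root (node ts) + countP₁s ts)
    ≡⟨ double-+-interchange (isN-root (node ts)) (countNs ts) (isP₁-root (node ts)) (countP₁s ts) ⟩
  (2 * isN-root (node ts) + isP₁-root (node ts)) + values ts
    ≡⟨ cong (_+ values ts) (root-value ts) ⟩
  2 ⊓ pChildren ts + values ts ∎
  where open ≡-Reasoning

isN-root+isP≡1 : ∀ t → isN-root t + bit (isP t) ≡ 1
isN-root+isP≡1 t with isP t
... | true  = refl
... | false = refl

chosenPChildEdges : ∀ {ts} → EdgeSets ts → ℕ
chosenPChildEdges []                      = 0
chosenPChildEdges {t ∷ _} ((b , _) ∷ ss) = bit b * bit (isP t) + chosenPChildEdges ss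

chosenPChildEdges≤chosenChildEdges : ∀ {ts} (ss : EdgeSets ts) →
  chosenPChildEdges ss ≤ chosenChildEdges ss
chosenPChildEdges≤chosenChildEdges [] = z≤n
chosenPChildEdges≤chosenChildEdges ((false , _) ∷ ss) = chosenPChildEdges≤chosenChildEdges ss
chosenPChildEdges≤chosenChildEdges {t ∷ _} ((true , _) ∷ ss) with isP t
... | true  = s≤s (chosenPChildEdges≤chosenChildEdges ss)
... | false = m≤n⇒m≤1+n (chosenPChildEdges≤chosenChildEdges ss)

chosenPChildEdges≤pChildren : ∀ {ts} (ss : EdgeSets ts) → chosenPChildEdges ss ≤ pChildren ts
chosenPChildEdges≤pChildren [] = z≤n
chosenPChildEdges≤pChildren {t ∷ _} ((false , _) ∷ ss) =
  ≤-trans (chosenPChildEdges≤pChildren ss) (m≤n+m _ (bit (isP t)))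
chosenPChildEdges≤pChildren {t ∷ _} ((true , _) ∷ ss) with isP t
... | true  = s≤s (chosenPChildEdges≤pChildren ss)
... | false = chosenPChildEdges≤pChildren ss

-- A root with at least two P-children is an N-vertex, so a used parent edge
-- costs exactly the one edge it removes from the degree budget.
root-budget : ∀ ts {c d} → d + c ≤ 2 →
  c ⊓ pChildren ts + d * isN-root (node ts) ≤ 2 ⊓ pChildren ts
root-budget ts {c} {d} d+c≤2 with pChildren ts
... | 0           = ≤-reflexive (cong₂ _+_ (⊓-zeroʳ c) (*-zeroʳ d))
... | 1           = ≤-trans (≤-reflexive (trans (cong (c ⊓ 1 +_) (*-zeroʳ d)) (+-identityʳ _)))
                            (m⊓n≤n c 1)
... | suc (suc k) = begin
  c ⊓ suc (suc k) + d * 1 ≤⟨ +-mono-≤ (m⊓n≤m c _) (≤-reflexive (*-identityʳ d)) ⟩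
  c + d                   ≡⟨ +-comm c d ⟩
  d + c                   ≤⟨ d+c≤2 ⟩
  2                       ∎
  where open ≤-Reasoning

edge-bound : ∀ b {t} (s : EdgeSet t) → bit b * isN-root t + size s ≤ value t →
  bit b + size s ≤ value t + bit b * bit (isP t)
edge-bound b {t} s bound = begin
  bit b + size s
    ≡⟨ cong (_+ size s) (sym (trans (cong (bit b *_) (isN-root+isP≡1 t)) (*-identityʳ (bit b)))) ⟩
  bit b * (isN-root t + bit (isP t)) + size s
    ≡⟨ solve 4 (λ x y n p → x :* (n :+ p) :+ y := (x :* n :+ y) :+ x :* p) refl
         (bit b) (size s) (isN-root t) (bit (isP t)) ⟩
  (bit b * isN-root t + size s) + bit b * bit (isP t)
    ≤⟨ +-monoˡ-≤ _ bound ⟩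
  value t + bit b * bit (isP t) ∎
  where open ≤-Reasoning

mutual
  size≤value : ∀ d {t} (S : EdgeSet t) → Deg≤2 d S → d * isN-root t + size S ≤ value t
  size≤value d {node ts} (node ss) (root-deg , children-deg) = begin
    d * isN-root (node ts) + sizes ss
      ≤⟨ +-monoʳ-≤ (d * isN-root (node ts)) (sizes≤values ss children-deg) ⟩
    d * isN-root (node ts) + (values ts + chosenPChildEdges ss)
      ≤⟨ +-monoʳ-≤ (d * isN-root (node ts)) (+-monoʳ-≤ (values ts) free-edges≤budget) ⟩
    d * isN-root (node ts) + (values ts + chosenChildEdges ss ⊓ pChildren ts)
      ≡⟨ solve 3 (λ x v m → x :+ (v :+ m) := (m :+ x) :+ v) refl
           (d * isN-root (node ts)) (values ts) (chosenChildEdges ss ⊓ pChildren ts) ⟩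
    (chosenChildEdges ss ⊓ pChildren ts + d * isN-root (node ts)) + values ts
      ≤⟨ +-monoˡ-≤ (values ts) (root-budget ts {chosenChildEdges ss} root-deg) ⟩
    2 ⊓ pChildren ts + values ts
      ≡⟨ value-node ts ⟨
    value (node ts) ∎
    where
    open ≤-Reasoning
    free-edges≤budget : chosenPChildEdges ss ≤ chosenChildEdges ss ⊓ pChildren ts
    free-edges≤budget = ⊓-glb (chosenPChildEdges≤chosenChildEdges ss) (chosenPChildEdges≤pChildren ss)

  sizes≤values : ∀ {ts} (ss : EdgeSets ts) → Deg≤2s ss → sizes ss ≤ values ts + chosenPChildEdges ss
  sizes≤values [] _ = z≤n
  sizes≤values {t ∷ ts} ((b , s) ∷ ss) (child-deg , rest-deg) = begin
    bit b + size s + sizes ss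
      ≤⟨ +-mono-≤ (edge-bound b s (size≤value (bit b) s child-deg)) (sizes≤values ss rest-deg) ⟩
    (value t + e) + (values ts + chosenPChildEdges ss)
      ≡⟨ solve 4 (λ v e w f → (v :+ e) :+ (w :+ f) := (v :+ w) :+ (e :+ f)) refl
           (value t) e (values ts) (chosenPChildEdges ss) ⟩
    (value t + values ts) + (e + chosenPChildEdges ss)
      ≡⟨ cong (_+ (e + chosenPChildEdges ss)) (values-∷ t ts) ⟨
    values (t ∷ ts) + (e + chosenPChildEdges ss) ∎
    where
    open ≤-Reasoning
    e = bit b * bit (isP t)

mutual
  greedy : ℕ → (t : Tree) → EdgeSet t
  greedy c (node ts) = node (greedyChildren c ts)

  greedyChildren : ℕ → (ts : List Tree) → EdgeSets ts
  greedyChildren c       []       = []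
  greedyChildren zero    (t ∷ ts) = (false , greedy 2 t) ∷ greedyChildren zero ts
  greedyChildren (suc c) (t ∷ ts) with isP t
  ... | true  = (true , greedy 1 t) ∷ greedyChildren c ts
  ... | false = (false , greedy 2 t) ∷ greedyChildren (suc c) ts

chosenChildEdges-greedyChildren : ∀ c ts → chosenChildEdges (greedyChildren c ts) ≤ c
chosenChildEdges-greedyChildren c       []       = z≤n
chosenChildEdges-greedyChildren zero    (t ∷ ts) = chosenChildEdges-greedyChildren zero ts
chosenChildEdges-greedyChildren (suc c) (t ∷ ts) with isP t
... | true  = s≤s (chosenChildEdges-greedyChildren c ts)
... | false = chosenChildEdges-greedyChildren (suc c) ts

mutual
  greedy-deg : ∀ {d c} t → d + c ≤ 2 → Deg≤2 d (greedy c t)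
  greedy-deg {d} {c} (node ts) d+c≤2 =
    ≤-trans (+-monoʳ-≤ d (chosenChildEdges-greedyChildren c ts)) d+c≤2 , greedyChildren-deg c ts

  greedyChildren-deg : ∀ c ts → Deg≤2s (greedyChildren c ts)
  greedyChildren-deg c       []       = tt
  greedyChildren-deg zero    (t ∷ ts) = greedy-deg t ≤-refl , greedyChildren-deg zero ts
  greedyChildren-deg (suc c) (t ∷ ts) with isP t
  ... | true  = greedy-deg t ≤-refl , greedyChildren-deg c ts
  ... | false = greedy-deg t ≤-refl , greedyChildren-deg (suc c) ts

isP⇒1⊓pChildren≡2⊓pChildren : ∀ ts → isP (node ts) ≡ true → 1 ⊓ pChildren ts ≡ 2 ⊓ pChildren ts
isP⇒1⊓pChildren≡2⊓pChildren ts isP-root with pChildren ts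
isP⇒1⊓pChildren≡2⊓pChildren ts ()      | suc (suc _)
... | 0 = refl
... | 1 = refl

mutual
  size-greedy-2 : ∀ t → size (greedy 2 t) ≡ value t
  size-greedy-2 (node ts) = trans (sizes-greedyChildren 2 ts) (sym (value-node ts))

  size-greedy-1 : ∀ t → isP t ≡ true → size (greedy 1 t) ≡ value t
  size-greedy-1 (node ts) isP-root = begin
    sizes (greedyChildren 1 ts)  ≡⟨ sizes-greedyChildren 1 ts ⟩
    1 ⊓ pChildren ts + values ts ≡⟨ cong (_+ values ts) (isP⇒1⊓pChildren≡2⊓pChildren ts isP-root) ⟩
    2 ⊓ pChildren ts + values ts ≡⟨ value-node ts ⟨
    value (node ts)              ∎
    where open ≡-Reasoning

  sizes-greedyChildren : ∀ c ts → sizes (greedyChildren c ts) ≡ c ⊓ pChildren ts + values ts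
  sizes-greedyChildren c [] = cong (_+ 0) (sym (⊓-zeroʳ c))
  sizes-greedyChildren zero (t ∷ ts) = begin
    size (greedy 2 t) + sizes (greedyChildren zero ts)
      ≡⟨ cong₂ _+_ (size-greedy-2 t) (sizes-greedyChildren zero ts) ⟩
    value t + values ts
      ≡⟨ values-∷ t ts ⟨
    values (t ∷ ts) ∎
    where open ≡-Reasoning
  sizes-greedyChildren (suc c) (t ∷ ts) with isP t in isP-t
  ... | true = begin
    suc (size (greedy 1 t) + sizes (greedyChildren c ts))
      ≡⟨ cong suc (cong₂ _+_ (size-greedy-1 t isP-t) (sizes-greedyChildren c ts)) ⟩
    suc (value t + (c ⊓ pChildren ts + values ts))
      ≡⟨ solve 3 (λ v m w → con 1 :+ (v :+ (m :+ w)) := (con 1 :+ m) :+ (v :+ w)) refl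
           (value t) (c ⊓ pChildren ts) (values ts) ⟩
    suc (c ⊓ pChildren ts) + (value t + values ts)
      ≡⟨ cong (suc (c ⊓ pChildren ts) +_) (values-∷ t ts) ⟨
    suc (c ⊓ pChildren ts) + values (t ∷ ts) ∎
    where open ≡-Reasoning
  ... | false = begin
    size (greedy 2 t) + sizes (greedyChildren (suc c) ts)
      ≡⟨ cong₂ _+_ (size-greedy-2 t) (sizes-greedyChildren (suc c) ts) ⟩
    value t + (suc c ⊓ pChildren ts + values ts)
      ≡⟨ solve 3 (λ v m w → v :+ (m :+ w) := m :+ (v :+ w)) refl
           (value t) (suc c ⊓ pChildren ts) (values ts) ⟩
    suc c ⊓ pChildren ts + (value t + values ts)
      ≡⟨ cong (suc c ⊓ pChildren ts +_) (values-∷ t ts) ⟨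
    suc c ⊓ pChildren ts + values (t ∷ ts) ∎
    where open ≡-Reasoning

proposition10 : (T : Tree) →
    (Σ (EdgeSet T) λ S → IsPathCollection S × size S ≡ 2 * countN T + countP₁ T)
    × ((S : EdgeSet T) → IsPathCollection S → size S ≤ 2 * countN T + countP₁ T)
proposition10 T =
  (greedy 2 T , greedy-deg T ≤-refl , size-greedy-2 T) , size≤value 0
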